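{- Let $G=G(A,B)$ be an irreducible graph with respect to a hereditary class $\mathcal{X}\subseteq Free(\{P_3+P_2\})$. Let $A'=\{a_1,\dots,a_k\}$ be an independent subset of $A$, and for each $i$ let $b_i\in N_B(a_i)\setminus\bigcup_{j\ne i}N_B(a_j)$. Then every element of $N_B(A')\setminus\{b_1,\dots,b_k\}$ is adjacent to all elements of $A'$.
   Context: $P_3+P_2$ is the disjoint union of paths on 3 and 2 vertices; $Free(\mathcal{F})$ is the class of graphs with no induced subgraph isomorphic to a member of $\mathcal{F}$; a class is hereditary if closed under vertex deletion. A graph $G$ with a partition $V(G)=A\cup B$ (written $G(A,B)$) is irreducible with respect to $\mathcal{X}$ if: $G\in\mathcal{X}$; $B$ is independent; no vertex of $B$ has degree one; there are no two distinct $u,v\in A$ with $N(u)\setminus A\subseteq N(v)\setminus A$; no vertex of $B$ is adjacent to all vertices of $A$; and $A$ is partitioned into (possibly empty) sets $A_1,A_2,A_3$ such that adding two new vertices $x,y$ and all edges $xx'$ for $x'\in A_1\cup A_3$ and $yy'$ for $y'\in A_2\cup A_3$ yields a graph $G'\in\mathcal{X}$. For $a\in A$, $N_B(a)=N(a)\cap B$, and $N_B(A')=\bigcup_{a\in A'}N_B(a)$. -}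

module Defs where

open import Data.Nat using (ℕ; zero; suc)
open import Data.Fin using (Fin; zero; suc)
open import Data.Bool using (Bool; true; false; _∧_; _∨_)
open import Data.Product using (Σ; _×_; _,_)
open import Relation.Binary.PropositionalEquality using (_≡_; _≢_; refl)
open import Relation.Nullary using (¬_)
open import Function.Definitions using (Injective)

record Graph : Set where
  field
    n     : ℕ
    adj   : Fin n → Fin n → Bool
    sym   : ∀ u v → adj u v ≡ adj v u
    irrefl : ∀ u → adj u u ≡ false
open Graph public

Edge : (G : Graph) → Fin (n G) → Fin (n G) → Set
Edge G u v = adj G u v ≡ true

InducedSub : Graph → Graph → Set
InducedSub H G =
  Σ (Fin (n H) → Fin (n G)) λ f →
    Injective _≡_ _≡_ f × (∀ u v → adj H u v ≡ adj G (f u) (f v))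

GraphClass : Set₁
GraphClass = Graph → Set

Hereditary : GraphClass → Set
Hereditary X = ∀ G H → InducedSub H G → X G → X H

-- Adjacency of P₃ + P₂ on Fin 5: path 0-1-2 and edge 3-4.
P3P2adj : Fin 5 → Fin 5 → Bool
P3P2adj zero (suc zero) = true
P3P2adj (suc zero) zero = true
P3P2adj (suc zero) (suc (suc zero)) = true
P3P2adj (suc (suc zero)) (suc zero) = true
P3P2adj (suc (suc (suc zero))) (suc (suc (suc (suc zero)))) = true
P3P2adj (suc (suc (suc (suc zero)))) (suc (suc (suc zero))) = true
P3P2adj _ _ = false

HasInducedP3P2 : Graph → Set
HasInducedP3P2 G =
  Σ (Fin 5 → Fin (n G)) λ f →
    Injective _≡_ _≡_ f × (∀ u v → adj G (f u) (f v) ≡ P3P2adj u v)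

P3P2Free : GraphClass
P3P2Free G = ¬ HasInducedP3P2 G

_⊆C_ : GraphClass → GraphClass → Set
X ⊆C Y = ∀ G → X G → Y G

InA : {m : ℕ} → (Fin m → Bool) → Fin m → Set
InA inA v = inA v ≡ true

InB : {m : ℕ} → (Fin m → Bool) → Fin m → Set
InB inA v = inA v ≡ false

-- Partition A = A₁ ∪ A₂ ∪ A₃ is given by a label lab : Fin n → Fin 3
-- (label 0 = A₁, 1 = A₂, 2 = A₃; labels of B-vertices are irrelevant).
toX : Fin 3 → Bool   -- member of A₁ ∪ A₃
toX zero = true
toX (suc zero) = false
toX (suc (suc zero)) = true

toY : Fin 3 → Bool   -- member of A₂ ∪ A₃
toY zero = false
toY (suc zero) = true
toY (suc (suc zero)) = true

-- G' : add x (= vertex 0) and y (= vertex 1); old vertex v becomes suc (suc v).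
extAdj : (G : Graph) → (Fin (n G) → Bool) → (Fin (n G) → Fin 3) →
         Fin (suc (suc (n G))) → Fin (suc (suc (n G))) → Bool
extAdj G inA lab zero zero = false
extAdj G inA lab zero (suc zero) = false
extAdj G inA lab (suc zero) zero = false
extAdj G inA lab (suc zero) (suc zero) = false
extAdj G inA lab zero (suc (suc v)) = inA v ∧ toX (lab v)
extAdj G inA lab (suc (suc v)) zero = inA v ∧ toX (lab v)
extAdj G inA lab (suc zero) (suc (suc v)) = inA v ∧ toY (lab v)
extAdj G inA lab (suc (suc v)) (suc zero) = inA v ∧ toY (lab v)
extAdj G inA lab (suc (suc u)) (suc (suc v)) = adj G u v

extSym : (G : Graph) (inA : Fin (n G) → Bool) (lab : Fin (n G) → Fin 3) →
         ∀ u v → extAdj G inA lab u v ≡ extAdj G inA lab v u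
extSym G inA lab zero zero = refl
extSym G inA lab zero (suc zero) = refl
extSym G inA lab (suc zero) zero = refl
extSym G inA lab (suc zero) (suc zero) = refl
extSym G inA lab zero (suc (suc v)) = refl
extSym G inA lab (suc (suc v)) zero = refl
extSym G inA lab (suc zero) (suc (suc v)) = refl
extSym G inA lab (suc (suc v)) (suc zero) = refl
extSym G inA lab (suc (suc u)) (suc (suc v)) = sym G u v

extIrrefl : (G : Graph) (inA : Fin (n G) → Bool) (lab : Fin (n G) → Fin 3) →
            ∀ u → extAdj G inA lab u u ≡ false
extIrrefl G inA lab zero = refl
extIrrefl G inA lab (suc zero) = refl
extIrrefl G inA lab (suc (suc u)) = irrefl G u

extend : (G : Graph) → (Fin (n G) → Bool) → (Fin (n G) → Fin 3) → Graph
extend G inA lab = record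
  { n = suc (suc (n G))
  ; adj = extAdj G inA lab
  ; sym = extSym G inA lab
  ; irrefl = extIrrefl G inA lab
  }

record Irreducible (X : GraphClass) (G : Graph) (inA : Fin (n G) → Bool) : Set where
  field
    inClass      : X G
    B-indep      : ∀ u v → InB inA u → InB inA v → ¬ Edge G u v
    B-noDegOne   : ∀ b → InB inA b →
                     ¬ (Σ (Fin (n G)) λ u → Edge G b u × (∀ w → Edge G b w → w ≡ u))
    A-noDominated : ∀ u v → InA inA u → InA inA v → u ≢ v →
                     ¬ (∀ w → InB inA w → Edge G u w → Edge G v w)
    B-notComplete : ∀ b → InB inA b → ¬ (∀ a → InA inA a → Edge G a b)
    extension    : Σ (Fin (n G) → Fin 3) λ lab → X (extend G inA lab)

module Submission where

-- Let a_i be the index with a_i ~ v and suppose some a_j were not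
-- adjacent to v.  Then i ≠ j, and the five vertices
--     b_i — a_i — v        a_j — b_j
-- induce P₃ + P₂: the only edges among them are b_i a_i, a_i v and a_j b_j,
-- because A' is independent, each b_i is a private neighbour of a_i, and
-- B is independent.  This contradicts G ∈ 𝒳 ⊆ Free({P₃ + P₂}).

open import Defs
open import Data.Nat using (ℕ)
open import Data.Fin using (Fin; zero; suc; _≟_)
open import Data.Fin.Properties using (all?; any?)
open import Data.Bool using (Bool; true; false)
open import Data.Bool.Properties using (¬-not) renaming (_≟_ to _≟ᵇ_)
open import Data.Product using (Σ; _×_; _,_; proj₁; proj₂)
open import Data.Product.Properties using () renaming (≡-dec to ×-≡-dec)
open import Data.Sum using (_⊎_; inj₁; inj₂)
open import Data.Empty using (⊥-elim)
open import Relation.Binary.PropositionalEquality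
  using (_≡_; _≢_; refl; trans; cong) renaming (sym to ≡-sym)
open import Function.Definitions using (Injective)
open import Relation.Nullary using (¬_; yes; no)
open import Relation.Nullary.Decidable using (toWitness; _⊎-dec_; ¬?)

nonEdge : (G : Graph) {u v : Fin (n G)} → ¬ Edge G u v → adj G u v ≡ false
nonEdge G = ¬-not

flip : (G : Graph) {u v : Fin (n G)} {c : Bool} → adj G u v ≡ c → adj G v u ≡ c
flip G {u} {v} e = trans (sym G v u) e

Separated : Fin 5 → Fin 5 → Set
Separated u v = Σ (Fin 5) λ w → P3P2adj u w ≢ P3P2adj v w

-- The two ends 0 and 2 of the P₃ are the only pair of distinct pattern
-- vertices with the same neighbourhood.
PathEnds : Fin 5 → Fin 5 → Set
PathEnds u v = (u , v) ≡ (zero , suc (suc zero)) ⊎ (u , v) ≡ (suc (suc zero) , zero)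

pattern-twins : ∀ u v → u ≡ v ⊎ Separated u v ⊎ PathEnds u v
pattern-twins = toWitness {a? = all? λ u → all? λ v →
  (u ≟ v) ⊎-dec (any? (λ w → ¬? (P3P2adj u w ≟ᵇ P3P2adj v w))
                 ⊎-dec (pair≟ (u , v) (zero , suc (suc zero))
                        ⊎-dec pair≟ (u , v) (suc (suc zero) , zero)))} _
  where
  pair≟ = ×-≡-dec _≟_ _≟_

-- Distinctness of all other pairs follows from the adjacencies; only the
-- path ends p and r, which have the same neighbourhood, must be kept apart.
module RecogniseP3P2
  (G : Graph) (p q r s t : Fin (n G)) (p≢r : p ≢ r)
  (pq : adj G p q ≡ true)  (pr : adj G p r ≡ false) (ps : adj G p s ≡ false)
  (pt : adj G p t ≡ false) (qr : adj G q r ≡ true)  (qs : adj G q s ≡ false)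
  (qt : adj G q t ≡ false) (rs : adj G r s ≡ false) (rt : adj G r t ≡ false)
  (st : adj G s t ≡ true) where

  embed : Fin 5 → Fin (n G)
  embed zero = p
  embed (suc zero) = q
  embed (suc (suc zero)) = r
  embed (suc (suc (suc zero))) = s
  embed (suc (suc (suc (suc zero)))) = t

  embed-adj : ∀ u v → adj G (embed u) (embed v) ≡ P3P2adj u v
  embed-adj zero zero = irrefl G p
  embed-adj zero (suc zero) = pq
  embed-adj zero (suc (suc zero)) = pr
  embed-adj zero (suc (suc (suc zero))) = ps
  embed-adj zero (suc (suc (suc (suc zero)))) = pt
  embed-adj (suc zero) zero = flip G pq
  embed-adj (suc zero) (suc zero) = irrefl G q
  embed-adj (suc zero) (suc (suc zero)) = qr
  embed-adj (suc zero) (suc (suc (suc zero))) = qs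
  embed-adj (suc zero) (suc (suc (suc (suc zero)))) = qt
  embed-adj (suc (suc zero)) zero = flip G pr
  embed-adj (suc (suc zero)) (suc zero) = flip G qr
  embed-adj (suc (suc zero)) (suc (suc zero)) = irrefl G r
  embed-adj (suc (suc zero)) (suc (suc (suc zero))) = rs
  embed-adj (suc (suc zero)) (suc (suc (suc (suc zero)))) = rt
  embed-adj (suc (suc (suc zero))) zero = flip G ps
  embed-adj (suc (suc (suc zero))) (suc zero) = flip G qs
  embed-adj (suc (suc (suc zero))) (suc (suc zero)) = flip G rs
  embed-adj (suc (suc (suc zero))) (suc (suc (suc zero))) = irrefl G s
  embed-adj (suc (suc (suc zero))) (suc (suc (suc (suc zero)))) = st
  embed-adj (suc (suc (suc (suc zero)))) zero = flip G pt
  embed-adj (suc (suc (suc (suc zero)))) (suc zero) = flip G qt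
  embed-adj (suc (suc (suc (suc zero)))) (suc (suc zero)) = flip G rt
  embed-adj (suc (suc (suc (suc zero)))) (suc (suc (suc zero))) = flip G st
  embed-adj (suc (suc (suc (suc zero)))) (suc (suc (suc (suc zero)))) = irrefl G t

  same-row : ∀ {u v} → embed u ≡ embed v → ∀ w → P3P2adj u w ≡ P3P2adj v w
  same-row {u} {v} e w =
    trans (≡-sym (embed-adj u w)) (trans (cong (λ x → adj G x (embed w)) e) (embed-adj v w))

  embed-injective : Injective _≡_ _≡_ embed
  embed-injective {u} {v} e with pattern-twins u v
  ... | inj₁ u≡v = u≡v
  ... | inj₂ (inj₁ (w , differ)) = ⊥-elim (differ (same-row e w))
  ... | inj₂ (inj₂ (inj₁ refl)) = ⊥-elim (p≢r e)
  ... | inj₂ (inj₂ (inj₂ refl)) = ⊥-elim (p≢r (≡-sym e))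

  inducedP3P2 : HasInducedP3P2 G
  inducedP3P2 = embed , embed-injective , embed-adj

private-neighbours-force-adjacency :
  (G : Graph) → P3P2Free G →
  (x y x′ y′ v : Fin (n G)) →
  ¬ Edge G x y → Edge G x x′ → Edge G y y′ →
  ¬ Edge G y x′ → ¬ Edge G x y′ → ¬ Edge G x′ y′ →
  Edge G x v → ¬ Edge G x′ v → ¬ Edge G v y′ → x′ ≢ v →
  Edge G y v
private-neighbours-force-adjacency G free x y x′ y′ v
  x≁y xx′ yy′ y≁x′ x≁y′ x′≁y′ xv x′≁v v≁y′ x′≢v with adj G y v in yv
... | true = refl
... | false = ⊥-elim (free (RecogniseP3P2.inducedP3P2 G x′ x v y y′ x′≢v
        (flip G xx′) (nonEdge G x′≁v) (flip G (nonEdge G y≁x′)) (nonEdge G x′≁y′)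
        xv (nonEdge G x≁y) (nonEdge G x≁y′)
        (flip G yv) (nonEdge G v≁y′) yy′))

lemma4 : (X : GraphClass) → Hereditary X → X ⊆C P3P2Free →
    (G : Graph) (inA : Fin (n G) → Bool) → Irreducible X G inA →
    (k : ℕ) (a : Fin k → Fin (n G)) →
    Injective _≡_ _≡_ a →
    (∀ i → InA inA (a i)) →
    (∀ i j → ¬ Edge G (a i) (a j)) →
    (b : Fin k → Fin (n G)) →
    (∀ i → InB inA (b i) × Edge G (a i) (b i)) →
    (∀ i j → i ≢ j → ¬ Edge G (a j) (b i)) →
    ∀ v → InB inA v → (Σ (Fin k) λ i → Edge G (a i) v) →
    (∀ i → v ≢ b i) →
    ∀ j → Edge G (a j) v
lemma4 X _ X⊆free G inA irr k a _ _ independent b private-nb not-private v v∈B (i , aᵢv) v≢b j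
  with i ≟ j
... | yes refl = aᵢv
... | no i≢j =
  private-neighbours-force-adjacency G (X⊆free G inClass) (a i) (a j) (b i) (b j) v
    (independent i j) (proj₂ (private-nb i)) (proj₂ (private-nb j))
    (not-private i j i≢j) (not-private j i (λ j≡i → i≢j (≡-sym j≡i)))
    (B-indep (b i) (b j) (proj₁ (private-nb i)) (proj₁ (private-nb j)))
    aᵢv (B-indep (b i) v (proj₁ (private-nb i)) v∈B)
    (B-indep v (b j) v∈B (proj₁ (private-nb j))) (λ e → v≢b i (≡-sym e))
  where open Irreducible irr
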